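{- For all integers $k\ge0$ and $m\ge0$, $$\delta_{k+m}(2k+1)=2^m\,\delta_k(2k+1).$$
   Context: Let $A_0=\begin{pmatrix}1&0&1\\0&1&1\\0&0&1\end{pmatrix}$, $A_1=\begin{pmatrix}0&0&1\\1&0&1\\0&1&1\end{pmatrix}$, $A_2=\begin{pmatrix}0&1&1\\0&0&1\\1&0&1\end{pmatrix}$. For a tuple $J=(j_1,\dots,j_n)$ with $j_i\in\{0,1,2\}$ ($n\ge0$) set $(v_1(J),v_2(J),v_3(J))=(1,1,1)A_{j_1}\cdots A_{j_n}$; these numbers, over all $J$ of length $n$, are the level-$n$ terms of Stern's triatomic sequence. For an integer $m$, $\delta_n(m)$ is the number of pairs $(J,k)$ with $J$ of length $n$, $k\in\{1,2,3\}$ and $v_k(J)=m$. -}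

module Defs where

open import Data.Nat using (ℕ; zero; suc; _+_)
open import Data.Fin using (Fin; zero; suc)
open import Data.Vec using (Vec; []; _∷_)
open import Data.List using (List; []; _∷_; map; concatMap)
open import Data.Nat.ListAction using (sum)
open import Data.Product using (_×_; _,_)
open import Data.Bool using (if_then_else_)
open import Relation.Nullary.Decidable using (⌊_⌋)
import Data.Nat as ℕ

Triple : Set
Triple = ℕ × ℕ × ℕ

-- Right multiplication of a row vector by A₀, A₁, A₂ (written out entrywise):
-- (x,y,z)A₀ = (x, y, x+y+z), (x,y,z)A₁ = (y, z, x+y+z), (x,y,z)A₂ = (z, x, x+y+z).
mulA : Fin 3 → Triple → Triple
mulA zero             (x , y , z) = x , y , x + y + z
mulA (suc zero)       (x , y , z) = y , z , x + y + z
mulA (suc (suc zero)) (x , y , z) = z , x , x + y + z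

-- v(J) = (1,1,1) A_{j₁} ⋯ A_{jₙ}, computed left to right.
vFrom : ∀ {n} → Triple → Vec (Fin 3) n → Triple
vFrom t []      = t
vFrom t (j ∷ J) = vFrom (mulA j t) J

v : ∀ {n} → Vec (Fin 3) n → Triple
v = vFrom (1 , 1 , 1)

allTuples : (n : ℕ) → List (Vec (Fin 3) n)
allTuples zero    = [] ∷ []
allTuples (suc n) =
  concatMap (λ j → map (j ∷_) (allTuples n))
            (zero ∷ suc zero ∷ suc (suc zero) ∷ [])

countEq : ℕ → Triple → ℕ
countEq m (a , b , c) = ind a + ind b + ind c
  where
  ind : ℕ → ℕ
  ind x = if ⌊ x ℕ.≟ m ⌋ then 1 else 0

δ : ℕ → ℕ → ℕ
δ n m = sum (map (λ J → countEq m (v J)) (allTuples n))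

-- Every entry at level n is positive and the entries of a level-n triple sum to at
-- least 2n + 3, since each step appends the sum of the triple and keeps two of its
-- positive entries. Passing from a triple (x, y, z) to its three children keeps each
-- of x, y, z exactly twice and adds copies of x + y + z only; from level k on that new
-- entry exceeds 2k + 1, so the number of occurrences of 2k + 1 doubles per level.
module Submission where

open import Defs
open import Data.Nat using (ℕ; _+_; _*_; _^_)
open import Relation.Binary.PropositionalEquality using (_≡_)

open import Data.Nat using (zero; suc; _≤_; _<_; s≤s; z≤n; _≟_)
open import Data.Nat.Properties
open import Data.Nat.ListAction using (sum)
open import Data.Nat.ListAction.Properties using (sum-++)
open import Data.Nat.Tactic.RingSolver using (solve-∀)
open import Data.Fin using (Fin; zero; suc)
open import Data.Vec using (Vec; []; _∷_)
open import Data.List using (List; []; _∷_; map; _++_; concatMap; allFin)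
open import Data.List.Properties using (map-++; map-∘; map-cong)
open import Data.Product using (_×_; _,_)
open import Data.Bool using (if_then_else_)
open import Relation.Nullary.Decidable using (⌊_⌋)
open import Function using (_∘_)
open import Relation.Nullary using (yes; no; contradiction)
open import Relation.Binary.PropositionalEquality
  using (refl; sym; trans; cong; module ≡-Reasoning)

sum-map-++ : ∀ {A : Set} (g : A → ℕ) (xs ys : List A) →
             sum (map g (xs ++ ys)) ≡ sum (map g xs) + sum (map g ys)
sum-map-++ g xs ys = trans (cong sum (map-++ g xs ys)) (sum-++ (map g xs) (map g ys))

sum-map-concatMap : ∀ {A B : Set} (g : B → ℕ) (h : A → List B) (xs : List A) →
                    sum (map g (concatMap h xs)) ≡ sum (map (sum ∘ map g ∘ h) xs)
sum-map-concatMap g h []       = refl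
sum-map-concatMap g h (x ∷ xs) =
  trans (sum-map-++ g (h x) (concatMap h xs)) (cong (sum (map g (h x)) +_) (sum-map-concatMap g h xs))

sum-map-*ˡ : ∀ {A : Set} (c : ℕ) (f : A → ℕ) (xs : List A) →
             sum (map (λ x → c * f x) xs) ≡ c * sum (map f xs)
sum-map-*ˡ c f []       = sym (*-zeroʳ c)
sum-map-*ˡ c f (x ∷ xs) =
  trans (cong (c * f x +_) (sum-map-*ˡ c f xs)) (sym (*-distribˡ-+ c (f x) (sum (map f xs))))

treeSum : ℕ → (Triple → ℕ) → Triple → ℕ
treeSum zero    f t = f t
treeSum (suc n) f t = sum (map (λ j → treeSum n f (mulA j t)) (allFin 3))

sum-allTuples : ∀ n (f : Triple → ℕ) t →
                sum (map (λ J → f (vFrom t J)) (allTuples n)) ≡ treeSum n f t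
sum-allTuples zero    f t = +-identityʳ (f t)
sum-allTuples (suc n) f t =
  trans (sum-map-concatMap (λ J → f (vFrom t J)) (λ j → map (j ∷_) (allTuples n)) (allFin 3))
        (cong sum (map-cong child (allFin 3)))
  where
  child : ∀ j → sum (map (λ J → f (vFrom t J)) (map (j ∷_) (allTuples n))) ≡ treeSum n f (mulA j t)
  child j = trans (cong sum (sym (map-∘ (allTuples n)))) (sum-allTuples n f (mulA j t))

treeSum-+ : ∀ a b f t → treeSum (a + b) f t ≡ treeSum a (treeSum b f) t
treeSum-+ zero    b f t = refl
treeSum-+ (suc a) b f t = cong sum (map-cong (λ j → treeSum-+ a b f (mulA j t)) (allFin 3))

treeSum-*ˡ : ∀ n c f t → treeSum n (λ u → c * f u) t ≡ c * treeSum n f t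
treeSum-*ˡ zero    c f t = refl
treeSum-*ˡ (suc n) c f t =
  trans (cong sum (map-cong (λ j → treeSum-*ˡ n c f (mulA j t)) (allFin 3)))
        (sum-map-*ˡ c (λ j → treeSum n f (mulA j t)) (allFin 3))

treeSum-cong : ∀ n {f g} t → (∀ (J : Vec (Fin 3) n) → f (vFrom t J) ≡ g (vFrom t J)) →
               treeSum n f t ≡ treeSum n g t
treeSum-cong zero    t eq = eq []
treeSum-cong (suc n) {f} {g} t eq =
  cong sum (map-cong (λ j → treeSum-cong n {f} {g} (mulA j t) (λ J → eq (j ∷ J))) (allFin 3))

sumT : Triple → ℕ
sumT (x , y , z) = x + y + z

Positive : Triple → Set
Positive (x , y , z) = (1 ≤ x) × (1 ≤ y) × (1 ≤ z)

sumT≤sumT-mulA : ∀ j t → sumT t ≤ sumT (mulA j t)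
sumT≤sumT-mulA zero             (x , y , z) = m≤n+m (x + y + z) (x + y)
sumT≤sumT-mulA (suc zero)       (x , y , z) = m≤n+m (x + y + z) (y + z)
sumT≤sumT-mulA (suc (suc zero)) (x , y , z) = m≤n+m (x + y + z) (z + x)

2+sumT≤sumT-mulA : ∀ j t → Positive t → 2 + sumT t ≤ sumT (mulA j t)
2+sumT≤sumT-mulA zero             (x , y , z) (x≥1 , y≥1 , _)   = +-monoˡ-≤ (x + y + z) (+-mono-≤ x≥1 y≥1)
2+sumT≤sumT-mulA (suc zero)       (x , y , z) (_ , y≥1 , z≥1)   = +-monoˡ-≤ (x + y + z) (+-mono-≤ y≥1 z≥1)
2+sumT≤sumT-mulA (suc (suc zero)) (x , y , z) (x≥1 , _ , z≥1)   = +-monoˡ-≤ (x + y + z) (+-mono-≤ z≥1 x≥1)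

Positive-mulA : ∀ j t → Positive t → Positive (mulA j t)
Positive-mulA zero             (x , y , z) (x≥1 , y≥1 , z≥1) = x≥1 , y≥1 , ≤-trans x≥1 (≤-trans (m≤m+n x y) (m≤m+n (x + y) z))
Positive-mulA (suc zero)       (x , y , z) (x≥1 , y≥1 , z≥1) = y≥1 , z≥1 , ≤-trans x≥1 (≤-trans (m≤m+n x y) (m≤m+n (x + y) z))
Positive-mulA (suc (suc zero)) (x , y , z) (x≥1 , y≥1 , z≥1) = z≥1 , x≥1 , ≤-trans x≥1 (≤-trans (m≤m+n x y) (m≤m+n (x + y) z))

2*n+sumT≤sumT-vFrom : ∀ {n} t (J : Vec (Fin 3) n) → Positive t → 2 * n + sumT t ≤ sumT (vFrom t J)
2*n+sumT≤sumT-vFrom t []      _   = ≤-refl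
2*n+sumT≤sumT-vFrom {suc n} t (j ∷ J) pos = begin
  2 * suc n + sumT t         ≡⟨ cong (_+ sumT t) (*-suc 2 n) ⟩
  2 + 2 * n + sumT t         ≡⟨ cong (_+ sumT t) (+-comm 2 (2 * n)) ⟩
  2 * n + 2 + sumT t         ≡⟨ +-assoc (2 * n) 2 (sumT t) ⟩
  2 * n + (2 + sumT t)       ≤⟨ +-monoʳ-≤ (2 * n) (2+sumT≤sumT-mulA j t pos) ⟩
  2 * n + sumT (mulA j t)    ≤⟨ 2*n+sumT≤sumT-vFrom (mulA j t) J (Positive-mulA j t pos) ⟩
  sumT (vFrom (mulA j t) J)  ∎
  where open ≤-Reasoning

indicator : ℕ → ℕ → ℕ
indicator m x = if ⌊ x ≟ m ⌋ then 1 else 0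

sum-countEq-mulA : ∀ m t → m < sumT t →
                   sum (map (λ j → countEq m (mulA j t)) (allFin 3)) ≡ 2 * countEq m t
sum-countEq-mulA m (x , y , z) m<s with x + y + z ≟ m
... | yes s≡m = contradiction (sym s≡m) (<⇒≢ m<s)
... | no _    = twice (indicator m x) (indicator m y) (indicator m z)
  where
  twice : ∀ a b c → a + b + 0 + (b + c + 0 + (c + a + 0 + 0)) ≡ 2 * (a + b + c)
  twice = solve-∀

treeSum-countEq : ∀ n m t → m < sumT t → treeSum n (countEq m) t ≡ 2 ^ n * countEq m t
treeSum-countEq zero    m t _   = sym (*-identityˡ (countEq m t))
treeSum-countEq (suc n) m t m<s = begin
  sum (map (λ j → treeSum n (countEq m) (mulA j t)) (allFin 3))
    ≡⟨ cong sum (map-cong (λ j → treeSum-countEq n m (mulA j t) (<-≤-trans m<s (sumT≤sumT-mulA j t))) (allFin 3)) ⟩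
  sum (map (λ j → 2 ^ n * countEq m (mulA j t)) (allFin 3))
    ≡⟨ sum-map-*ˡ (2 ^ n) (λ j → countEq m (mulA j t)) (allFin 3) ⟩
  2 ^ n * sum (map (λ j → countEq m (mulA j t)) (allFin 3))
    ≡⟨ cong (2 ^ n *_) (sum-countEq-mulA m t m<s) ⟩
  2 ^ n * (2 * countEq m t)
    ≡⟨ *-assoc (2 ^ n) 2 (countEq m t) ⟨
  2 ^ n * 2 * countEq m t
    ≡⟨ cong (_* countEq m t) (*-comm (2 ^ n) 2) ⟩
  2 ^ suc n * countEq m t ∎
  where open ≡-Reasoning

2*n+1<sumT-v : ∀ {n} (J : Vec (Fin 3) n) → 2 * n + 1 < sumT (v J)
2*n+1<sumT-v {n} J =
  <-≤-trans (+-monoʳ-< (2 * n) (s≤s (s≤s z≤n)))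
            (2*n+sumT≤sumT-vFrom (1 , 1 , 1) J (s≤s z≤n , s≤s z≤n , s≤s z≤n))

δ≡treeSum : ∀ n m → δ n m ≡ treeSum n (countEq m) (1 , 1 , 1)
δ≡treeSum n m = sum-allTuples n (countEq m) (1 , 1 , 1)

mainTheorem10 : (k m : ℕ) → δ (k + m) (2 * k + 1) ≡ 2 ^ m * δ k (2 * k + 1)
mainTheorem10 k m = begin
  δ (k + m) M                               ≡⟨ δ≡treeSum (k + m) M ⟩
  treeSum (k + m) (countEq M) one           ≡⟨ treeSum-+ k m (countEq M) one ⟩
  treeSum k (treeSum m (countEq M)) one     ≡⟨ treeSum-cong k one (λ J → treeSum-countEq m M (v J) (2*n+1<sumT-v J)) ⟩
  treeSum k (λ u → 2 ^ m * countEq M u) one ≡⟨ treeSum-*ˡ k (2 ^ m) (countEq M) one ⟩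
  2 ^ m * treeSum k (countEq M) one         ≡⟨ cong (2 ^ m *_) (δ≡treeSum k M) ⟨
  2 ^ m * δ k M                             ∎
  where
  open ≡-Reasoning
  M : ℕ
  M = 2 * k + 1
  one : Triple
  one = 1 , 1 , 1
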